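{- Let $T$ be the final tree output by Algorithm 2 (described in the context) applied to the output of Algorithm 1 with parameters $\alpha>1$, $\beta\ge(\alpha+1)/(\alpha-1)$, $\gamma>1$, $\delta>1$. For $i\in L$, let $T_{B_i}$ be the tree $T$ as it stands just after the iteration of Algorithm 2 in which $C_i$ is added. Then $A_0(T_{B_i})\le \frac{\beta\gamma}{\gamma-1}B_i$, where $A_0(T_{B_i})=\sum_{e\in T_{B_i}} l_e\min\{x_e,1\}$ with $x_e$ the flows in $T$.
   Context: Instance: a connected undirected graph $G=(V,E)$ with nonnegative edge lengths $l_e$, a root $r\in V$, and a set $\mathcal{D}\subseteq V$ of demand nodes with positive integer demands $d_v$; $D=\sum_v d_v$. A routing tree is a tree $T$ in $G$ containing $r$ and all demand nodes; each demand node $v$ sends $d_v$ units of flow along the unique $v$–$r$ path in $T$, giving total flow $x_e$ on each edge $e$ of $T$; $g(T)=\sum_{e\in T}l_e g(x_e)$. Fix $\epsilon>0$, let $K=\lceil \log_{1+\epsilon} D\rceil$, and for $0\le i\le K$ let $M_i=(1+\epsilon)^i$, $A_i(x)=\min\{x,M_i\}$, and $T_i^*$ a routing tree minimizing $A_i(\cdot)$. A $\lambda$-approximation for single-sink rent-or-buy returns, for each $i$, a routing tree $T$ with $A_i(T)\le\lambda A_i(T_i^*)$. For a routing tree $T_i$ with flows $x_e$, its rent cost is $R_i=\sum_{e\in T_i,\,x_e<M_i} l_e x_e$, its normalized buy cost is $B_i=\sum_{e\in T_i,\,x_e\ge M_i} l_e$, and its core $C_i$ consists of $r$ together with all endpoints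 of edges with $x_e\ge M_i$. Algorithm 1 (parameters $\gamma>1,\delta>1$): (1) for each $i=0,\dots,K$ let $T_i$ be the tree returned by the $\lambda$-approximation for $A_i$; (2) for $i=1,\dots,K$ in increasing order, if $A_i(T_{i-1})<A_i(T_i)$ replace $T_i$ by $T_{i-1}$; (3) for $i=K-1,\dots,0$ in decreasing order, if $A_i(T_{i+1})<A_i(T_i)$ replace $T_i$ by $T_{i+1}$; (4) compute $C_i,B_i,R_i$ for the resulting trees $T_i$; (5) set $B=\infty$, $L_B=\emptyset$, and for $i=0,\dots,K$ in increasing order, if $B_i<B/\gamma$ add $i$ to $L_B$ and set $B\leftarrow B_i$; (6) set $R=\infty$, $L=\emptyset$, and for $i\in L_B$ in decreasing order, if $R_i<R/\delta$ add $i$ to $L$ and set $R\leftarrow R_i$. Output $L$ and the cores $C_i$, $i\in L$ (with their values $B_i,R_i$). For $\alpha,\beta\ge1$, an $(\alpha,\beta)$-LAST of a graph $H$ with root $s$ is a spanning tree of $H$ in which every vertex's tree distance to $s$ is at most $\alpha$ times its shortest-path distance to $s$ in $H$, and whose total edge length is at most $\beta$ times that of a minimum spanning tree of $H$; one exists and can be computed whenever $\alpha>1$ and $\beta\ge(\alpha+1)/(\alpha-1)$. Algorithm 2 (parameters $\alpha>1$, $\beta\ge(\alpha+1)/(\alpha-1)$): start with $T=\{r\}$; for each $i\in L$ in decreasing order, let $T'$ be an $(\alpha,\beta)$-LAST of the graph $(G/T)[C_i]$ (obtained from $G$ by contracting the current $T$ to a single vertex and then taking the subgraph induced on $C_i$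 together with the contracted vertex), rooted at the contracted vertex, and set $T\leftarrow T\cup T'$ (edges of $T'$ read as edges of $G$). Output $T$.
   Formalization: The edge lengths $l_e$ and the parameters ε, λ, α, β, γ, δ are rational. -}

module Defs where

open import Data.Nat as ℕ using (ℕ; zero; suc; _∸_)
open import Data.Fin as Fin using (Fin)
open import Data.Fin.Properties as FinP using ()
open import Data.Integer using (+_)
open import Data.Rational as ℚ using (ℚ; 0ℚ; 1ℚ; _+_; _*_; _⊓_; _<?_)
open import Data.List using (List; []; _∷_; _++_; map; foldr; concatMap; reverse; filter; allFin)
open import Data.List.Membership.Propositional using (_∈_; _∉_)
import Data.List.Membership.DecPropositional as DecMem
open import Data.List.Relation.Unary.Unique.Propositional using (Unique)
open import Data.List.Relation.Unary.All using (All)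
open import Data.Maybe using (Maybe; nothing; just)
open import Data.Product using (Σ; _×_; _,_; proj₁; proj₂)
open import Data.Sum using (_⊎_)
open import Data.Bool using (Bool; true; false; if_then_else_)
open import Relation.Nullary using (¬_; does)
open import Relation.Binary.PropositionalEquality using (_≡_; _≢_)

toℚ : ℕ → ℚ
toℚ n = (+ n) ℚ./ 1

_^ℚ_ : ℚ → ℕ → ℚ
p ^ℚ zero  = 1ℚ
p ^ℚ suc k = p * (p ^ℚ k)

sumℚ : List ℚ → ℚ
sumℚ = foldr _+_ 0ℚ

-- Walks in a (multi)graph whose edges are indexed by Fin m.
-- ends e = the two endpoints of edge e; Q = the set of usable edges.

Joins : ∀ {m} {V : Set} → (Fin m → V × V) → Fin m → V → V → Set
Joins ends e u w = (ends e ≡ (u , w)) ⊎ (ends e ≡ (w , u))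

data Walk {m} {V : Set} (ends : Fin m → V × V) (Q : Fin m → Set) : V → V → Set where
  []   : ∀ {u} → Walk ends Q u u
  step : ∀ {u w v} (e : Fin m) → Q e → Joins ends e u w → Walk ends Q w v → Walk ends Q u v

wEdges : ∀ {m} {V : Set} {ends : Fin m → V × V} {Q : Fin m → Set} {u v : V} →
         Walk ends Q u v → List (Fin m)
wEdges []               = []
wEdges (step e _ _ w)   = e ∷ wEdges w

wVerts : ∀ {m} {V : Set} {ends : Fin m → V × V} {Q : Fin m → Set} {u v : V} →
         Walk ends Q u v → List V
wVerts {u = u} []       = u ∷ []
wVerts {u = u} (step e _ _ w) = u ∷ wVerts w

weight : ∀ {m} → (Fin m → ℚ) → List (Fin m) → ℚ
weight len F = sumℚ (map len F)

wLen : ∀ {m} {V : Set} {ends : Fin m → V × V} {Q : Fin m → Set} {u v : V} →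
       (Fin m → ℚ) → Walk ends Q u v → ℚ
wLen len w = weight len (wEdges w)

InMinus : ∀ {m} → List (Fin m) → Fin m → Fin m → Set
InMinus F e e' = (e' ∈ F) × (e' ≢ e)

-- F (list of edges, each allowed by Q) is a spanning tree, rooted at s, of the
-- graph with vertex set P and edge set Q: F has no repeated edge, uses only
-- edges of the graph, connects every vertex of P to s, and is acyclic
-- (removing any edge of F disconnects its endpoints).
IsSpanningTree : ∀ {m} {V : Set} (ends : Fin m → V × V) (P : V → Set) (Q : Fin m → Set)
                 (s : V) (F : List (Fin m)) → Set
IsSpanningTree ends P Q s F =
  Unique F × All Q F ×
  (∀ v → P v → Walk ends (_∈ F) v s) ×
  (∀ e → e ∈ F → ¬ Walk ends (InMinus F e) (proj₁ (ends e)) (proj₂ (ends e)))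

IsMST : ∀ {m} {V : Set} (ends : Fin m → V × V) (len : Fin m → ℚ) (P : V → Set)
        (Q : Fin m → Set) (s : V) (F : List (Fin m)) → Set
IsMST ends len P Q s F =
  IsSpanningTree ends P Q s F ×
  (∀ F' → IsSpanningTree ends P Q s F' → weight len F ℚ.≤ weight len F')

-- (α,β)-LAST rooted at s of the graph (P,Q):
--  * a spanning tree;
--  * tree distance from every vertex v to s is ≤ α · (shortest-path distance
--    in the graph), i.e. for every walk W from v to s in the graph there is a
--    walk in the tree from v to s of length ≤ α · length(W);
--  * total length ≤ β · (length of a minimum spanning tree).
IsLAST : ∀ {m} {V : Set} (ends : Fin m → V × V) (len : Fin m → ℚ) (α β : ℚ)
         (P : V → Set) (Q : Fin m → Set) (s : V) (F : List (Fin m)) → Set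
IsLAST ends len α β P Q s F =
  IsSpanningTree ends P Q s F ×
  (∀ v → P v → (W : Walk ends Q v s) →
     Σ (Walk ends (_∈ F) v s) λ W' → wLen len W' ℚ.≤ α * wLen len W) ×
  (∀ F* → IsMST ends len P Q s F* → weight len F ℚ.≤ β * weight len F*)

record Instance : Set where
  field
    n    : ℕ
    m    : ℕ
    ends : Fin m → Fin n × Fin n
    len  : Fin m → ℚ
    root : Fin n
    dem  : Fin n → ℕ              -- demands; demand nodes are those with dem v > 0

module _ (I : Instance) where
  open Instance I

  NoLoops : Set
  NoLoops = ∀ e → proj₁ (ends e) ≢ proj₂ (ends e)

  NoParallel : Set
  NoParallel = ∀ e e' → e ≢ e' → ¬ Joins ends e' (proj₁ (ends e)) (proj₂ (ends e))

  Connected : Set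
  Connected = ∀ v → Walk ends (λ _ → Data.Unit.⊤) v root
    where import Data.Unit

  NonnegLengths : Set
  NonnegLengths = ∀ e → 0ℚ ℚ.≤ len e

  totalDemand : ℕ
  totalDemand = foldr ℕ._+_ 0 (map dem (allFin n))

  IsRoutingTree : List (Fin m) → Set
  IsRoutingTree F =
    Unique F ×
    (∀ e → e ∈ F → Walk ends (_∈ F) (proj₁ (ends e)) root × Walk ends (_∈ F) (proj₂ (ends e)) root) ×
    (∀ v → 0 ℕ.< dem v → Walk ends (_∈ F) v root) ×
    (∀ e → e ∈ F → ¬ Walk ends (InMinus F e) (proj₁ (ends e)) (proj₂ (ends e)))

  OnPath : List (Fin m) → Fin m → Fin n → Set
  OnPath F e v = Σ (Walk ends (_∈ F) v root) λ W → Unique (wVerts W) × (e ∈ wEdges W)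

  data FlowSum (F : List (Fin m)) (e : Fin m) : List (Fin n) → ℕ → Set where
    fnil  : FlowSum F e [] 0
    fon   : ∀ {v vs s} → OnPath F e v → FlowSum F e vs s → FlowSum F e (v ∷ vs) (dem v ℕ.+ s)
    foff  : ∀ {v vs s} → ¬ OnPath F e v → FlowSum F e vs s → FlowSum F e (v ∷ vs) s

  IsFlowOf : List (Fin m) → (Fin m → ℕ) → Set
  IsFlowOf F x = ∀ e → e ∈ F → FlowSum F e (allFin n) (x e)

  record RTree : Set where
    constructor rtree
    field
      edges : List (Fin m)
      flow  : Fin m → ℕ

  open RTree public

  ValidRTree : RTree → Set
  ValidRTree T = IsRoutingTree (edges T) × IsFlowOf (edges T) (flow T)

  M : ℚ → ℕ → ℚ
  M ε i = (1ℚ + ε) ^ℚ i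

  Acost : ℚ → ℕ → RTree → ℚ
  Acost ε i T = sumℚ (map (λ e → len e * (toℚ (flow T e) ⊓ M ε i)) (edges T))

  -- K = ⌈log_{1+ε} D⌉ : the least k with (1+ε)^k ≥ D
  IsCeilLog : ℚ → ℕ → Set
  IsCeilLog ε K = (toℚ totalDemand ℚ.≤ M ε K) × (∀ k → k ℕ.< K → M ε k ℚ.< toℚ totalDemand)

  -- Step (2): increasing pass. T1 i = tree at position i after the pass.
  step2 : ℚ → (ℕ → RTree) → ℕ → RTree
  step2 ε T0 zero    = T0 zero
  step2 ε T0 (suc i) =
    if does (Acost ε (suc i) (step2 ε T0 i) <? Acost ε (suc i) (T0 (suc i)))
    then step2 ε T0 i else T0 (suc i)

  -- Step (3): decreasing pass; aux j = tree at position K ∸ j.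
  step3aux : ℚ → ℕ → (ℕ → RTree) → ℕ → RTree
  step3aux ε K T1 zero    = T1 K
  step3aux ε K T1 (suc j) =
    let i = K ∸ suc j in
    if does (Acost ε i (step3aux ε K T1 j) <? Acost ε i (T1 i))
    then step3aux ε K T1 j else T1 i

  step3 : ℚ → ℕ → (ℕ → RTree) → ℕ → RTree
  step3 ε K T1 i = step3aux ε K T1 (K ∸ i)

  finalTrees : ℚ → ℕ → (ℕ → RTree) → ℕ → RTree
  finalTrees ε K T0 = step3 ε K (step2 ε T0)

  isBuy : ℚ → ℕ → RTree → Fin m → Bool
  isBuy ε i T e = does (M ε i ℚ.≤? toℚ (flow T e))

  Bcost : ℚ → ℕ → RTree → ℚ
  Bcost ε i T = sumℚ (map (λ e → if isBuy ε i T e then len e else 0ℚ) (edges T))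

  Rcost : ℚ → ℕ → RTree → ℚ
  Rcost ε i T = sumℚ (map (λ e → if isBuy ε i T e then 0ℚ else len e * toℚ (flow T e)) (edges T))

  InCore : ℚ → ℕ → RTree → Fin n → Set
  InCore ε i T v =
    (v ≡ root) ⊎
    Σ (Fin m) λ e → (e ∈ edges T) × (M ε i ℚ.≤ toℚ (flow T e)) ×
                    ((v ≡ proj₁ (ends e)) ⊎ (v ≡ proj₂ (ends e)))

  -- Step (5): scan i = 0..K increasing; B = nothing encodes B = ∞.
  -- The test B_i < B/γ is written B_i·γ < B (γ > 0).
  step5 : ℚ → (ℕ → ℚ) → List ℕ → Maybe ℚ → List ℕ
  step5 γ Bv []       B = []
  step5 γ Bv (i ∷ is) nothing  = i ∷ step5 γ Bv is (just (Bv i))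
  step5 γ Bv (i ∷ is) (just b) =
    if does (Bv i * γ <? b) then i ∷ step5 γ Bv is (just (Bv i)) else step5 γ Bv is (just b)

  -- Step (6): scan a list (already in decreasing order); R = nothing is ∞.
  -- The test R_i < R/δ is written R_i·δ < R (δ > 0).
  step6 : ℚ → (ℕ → ℚ) → List ℕ → Maybe ℚ → List ℕ
  step6 δ Rv []       R = []
  step6 δ Rv (i ∷ is) nothing  = i ∷ step6 δ Rv is (just (Rv i))
  step6 δ Rv (i ∷ is) (just b) =
    if does (Rv i * δ <? b) then i ∷ step6 δ Rv is (just (Rv i)) else step6 δ Rv is (just b)

  upToK : ℕ → List ℕ
  upToK K = Data.List.upTo (suc K)
    where import Data.List

  -- Output L of Algorithm 1 (in decreasing order), given the step-(1) trees
  LB : ℚ → ℚ → ℕ → (ℕ → RTree) → List ℕ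
  LB ε γ K T0 = step5 γ (λ i → Bcost ε i (finalTrees ε K T0 i)) (upToK K) nothing

  Lout : ℚ → ℚ → ℚ → ℕ → (ℕ → RTree) → List ℕ
  Lout ε γ δ K T0 =
    step6 δ (λ i → Rcost ε i (finalTrees ε K T0 i)) (reverse (LB ε γ K T0)) nothing

  treeVerts : List (Fin m) → List (Fin n)
  treeVerts T = root ∷ concatMap (λ e → proj₁ (ends e) ∷ proj₂ (ends e) ∷ []) T

  -- contraction map: vertices of T ↦ nothing (the contracted vertex)
  contr : List (Fin m) → Fin n → Maybe (Fin n)
  contr T v = if does (DecMem._∈?_ Fin._≟_ v (treeVerts T)) then nothing else just v

  contrEnds : List (Fin m) → Fin m → Maybe (Fin n) × Maybe (Fin n)
  contrEnds T e = contr T (proj₁ (ends e)) , contr T (proj₂ (ends e))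

  HVert : List (Fin m) → (Fin n → Set) → Maybe (Fin n) → Set
  HVert T C w = (w ≡ nothing) ⊎ Σ (Fin n) λ v → (w ≡ just v) × C v × (v ∉ treeVerts T)

  HEdge : List (Fin m) → (Fin n → Set) → Fin m → Set
  HEdge T C e = HVert T C (proj₁ (contrEnds T e)) × HVert T C (proj₂ (contrEnds T e)) ×
                (proj₁ (contrEnds T e) ≢ proj₂ (contrEnds T e))

module Submission where

-- T_{B_i} is the union of the LASTs T'_j for the indices j of L up to i.  Since
-- min{x_e, 1} ≤ 1, A_0(T_{B_i}) ≤ Σ_j l(T'_j), and the lemma follows from
--  (a) l(T'_j) ≤ β B_j: in a routing tree flows do not decrease towards the
--      root, so the buy edges of T_j (x_e ≥ M_j) join every vertex of the core
--      C_j to r; those surviving the contraction of the current tree therefore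
--      connect (G/T)[C_j], contain a spanning tree of weight ≤ B_j, hence an MST
--      is no heavier, and a LAST weighs at most β times an MST;
--  (b) (γ - 1) Σ_j B_j ≤ γ B_i: steps (5)-(6) of Algorithm 1 keep only indices
--      whose B-values grow by a factor > γ along L, a geometric sequence
--      ending at B_i.
-- Spanning trees and MSTs are found by finite search under double negation,
-- which is eliminated because the goal is a decidable inequality of rationals.

open import Defs
open import Data.Nat using (ℕ; _≤_)
open import Data.Rational using (ℚ; 0ℚ; 1ℚ; _+_; _*_; _-_; _⊓_; _<_)
open import Data.Rational as Q using ()
open import Data.List using (List; _∷_; []; _++_; map; concatMap)
open import Data.Fin using (Fin)
open import Data.Maybe using (nothing)
open import Relation.Binary.PropositionalEquality using (_≡_)

import Level
open import Data.Nat as ℕ using (zero; suc; _∸_)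
import Data.Nat.Properties as ℕP
import Data.Integer as ℤ
import Data.Integer.Properties as ℤP
import Data.Nat.Coprimality as Coprimality
import Data.Rational.Properties as ℚP
open import Data.Rational.Solver using (module +-*-Solver)
import Data.Fin as Fin
open import Data.Maybe using (Maybe; just)
import Data.Maybe.Properties as MaybeP
open import Data.Bool using (if_then_else_)
open import Data.Product using (Σ; _×_; _,_; proj₁; proj₂)
open import Data.Product.Properties using (,-injectiveˡ; ,-injectiveʳ)
open import Data.Sum using (_⊎_; inj₁; inj₂; [_,_]′)
open import Data.Empty using (⊥-elim)
open import Function using (flip)
open import Data.List using (filter; length; allFin; reverse)
import Data.List.Properties as ListP
open import Data.List.Membership.Propositional using (_∈_; _∉_)
open import Data.List.Membership.Propositional.Properties
  using (∈-++⁻; ∈-++⁺ˡ; ∈-++⁺ʳ; ∈-∃++; ∈-filter⁺; ∈-filter⁻; ∈-map⁺; ∈-concatMap⁺; ∈-allFin)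
import Data.List.Membership.DecPropositional as DecMembership
import Data.List.Relation.Unary.Any as Any
open Any using (here; there)
import Data.List.Relation.Unary.Any.Properties as AnyP
open import Data.List.Relation.Unary.All as All using (All; []; _∷_)
import Data.List.Relation.Unary.All.Properties as AllP
open import Data.List.Relation.Unary.AllPairs as AllPairs using (AllPairs; []; _∷_)
import Data.List.Relation.Unary.AllPairs.Properties as AllPairsP
open import Data.List.Relation.Unary.Unique.Propositional using (Unique)
import Data.List.Relation.Unary.Unique.Propositional.Properties as UniqueP
open import Relation.Nullary using (¬_; Dec; yes; no; does; ¬?; ¬¬-excluded-middle; decidable-stable)
open import Relation.Nullary.Decidable using (_×-dec_)
open import Relation.Nullary.Negation using (¬¬-Monad)
open import Relation.Binary.PropositionalEquality using (_≢_; refl; sym; trans; cong; subst; subst₂)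
open import Effect.Monad using (RawMonad)
open RawMonad (¬¬-Monad {Level.zero}) using (return; _>>=_)

if-elim : ∀ {A B : Set} (P : B → Set) {x y : B} (d : Dec A) →
          (A → P x) → (¬ A → P y) → P (if does d then x else y)
if-elim P (yes a) onYes onNo = onYes a
if-elim P (no ¬a) onYes onNo = onNo ¬a

LightestAmong : ∀ {A : Set} (P : A → Set) (w : A → ℚ) (cs : List A) (b : A) → Set
LightestAmong {A} P w cs b = Σ A λ a → P a × w a Q.≤ w b × (∀ c → c ∈ cs → P c → w a Q.≤ w c)

¬¬-minimum : ∀ {A : Set} (P : A → Set) (w : A → ℚ) (cs : List A) (b : A) → P b →
             ¬ ¬ LightestAmong P w cs b
¬¬-minimum P w []       b pb = return (b , pb , ℚP.≤-refl , λ _ ())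
¬¬-minimum P w (c ∷ cs) b pb = ¬¬-excluded-middle >>= λ where
    (no ¬pc) → ¬¬-minimum P w cs b pb >>= λ (a , pa , a≤b , min) →
      return (a , pa , a≤b , λ { _ (here refl) pc → ⊥-elim (¬pc pc) ; c' (there c'∈) → min c' c'∈ })
    (yes pc) → [ lighter pc , heavier ]′ (ℚP.≤-total (w c) (w b))
  where
  lighter : P c → w c Q.≤ w b → ¬ ¬ LightestAmong P w (c ∷ cs) b
  lighter pc c≤b = ¬¬-minimum P w cs c pc >>= λ (a , pa , a≤c , min) →
    return (a , pa , ℚP.≤-trans a≤c c≤b , λ { _ (here refl) _ → a≤c ; c' (there c'∈) → min c' c'∈ })
  heavier : w b Q.≤ w c → ¬ ¬ LightestAmong P w (c ∷ cs) b
  heavier b≤c = ¬¬-minimum P w cs b pb >>= λ (a , pa , a≤b , min) →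
    return (a , pa , a≤b , λ { _ (here refl) _ → ℚP.≤-trans a≤b b≤c ; c' (there c'∈) → min c' c'∈ })

toℚ≡mkℚ : ∀ n → toℚ n ≡ Q.mkℚ (ℤ.+ n) 0 (Coprimality.sym (Coprimality.1-coprimeTo n))
toℚ≡mkℚ n = ℚP.normalize-coprime (Coprimality.sym (Coprimality.1-coprimeTo n))

toℚ-mono : ∀ {a b} → a ℕ.≤ b → toℚ a Q.≤ toℚ b
toℚ-mono {a} {b} a≤b rewrite toℚ≡mkℚ a | toℚ≡mkℚ b =
  Q.*≤* (subst₂ ℤ._≤_ (sym (ℤP.*-identityʳ (ℤ.+ a))) (sym (ℤP.*-identityʳ (ℤ.+ b))) (ℤ.+≤+ a≤b))

1≰0 : ¬ (1ℚ Q.≤ 0ℚ)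
1≰0 (Q.*≤* (ℤ.+≤+ ()))

0≤p-1 : ∀ {p} → 1ℚ Q.≤ p → 0ℚ Q.≤ p - 1ℚ
0≤p-1 {p} 1≤p = ℚP.≤-trans (ℚP.≤-reflexive (sym (ℚP.+-inverseʳ 1ℚ))) (ℚP.+-monoˡ-≤ (Q.- 1ℚ) 1≤p)

1≤M : ∀ I {ε} → 0ℚ Q.≤ ε → ∀ i → 1ℚ Q.≤ M I ε i
1≤M I       ε≥0 zero    = ℚP.≤-refl
1≤M I {ε} ε≥0 (suc i) = begin
  1ℚ                     ≤⟨ 1≤M I ε≥0 i ⟩
  Mi                     ≡⟨ sym (ℚP.*-identityˡ Mi) ⟩
  1ℚ * Mi                ≤⟨ ℚP.*-monoʳ-≤-nonNeg Mi {{Q.nonNegative (ℚP.≤-trans (ℚP.<⇒≤ (ℚP.positive⁻¹ 1ℚ)) (1≤M I ε≥0 i))}} 1≤1+ε ⟩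
  (1ℚ + ε) * Mi          ∎
  where
  open ℚP.≤-Reasoning
  Mi = M I ε i
  1≤1+ε : 1ℚ Q.≤ 1ℚ + ε
  1≤1+ε = ℚP.≤-trans (ℚP.≤-reflexive (sym (ℚP.+-identityʳ 1ℚ))) (ℚP.+-monoʳ-≤ 1ℚ ε≥0)

β-nonneg : ∀ {α β} → 1ℚ < α → α + 1ℚ Q.≤ β * (α - 1ℚ) → 0ℚ Q.≤ β
β-nonneg {α} {β} α>1 αβ with ℚP.≤-total 0ℚ β
... | inj₁ 0≤β = 0≤β
... | inj₂ β≤0 = ⊥-elim (ℚP.<-irrefl refl (begin-strict
  0ℚ              ≡⟨ sym (ℚP.+-identityʳ 0ℚ) ⟩
  0ℚ + 0ℚ         <⟨ ℚP.+-mono-< (ℚP.<-trans 0<1 α>1) 0<1 ⟩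
  α + 1ℚ          ≤⟨ αβ ⟩
  β * (α - 1ℚ)    ≤⟨ ℚP.*-monoʳ-≤-nonNeg (α - 1ℚ) {{Q.nonNegative (0≤p-1 (ℚP.<⇒≤ α>1))}} β≤0 ⟩
  0ℚ * (α - 1ℚ)   ≡⟨ ℚP.*-zeroˡ (α - 1ℚ) ⟩
  0ℚ              ∎))
  where
  open ℚP.≤-Reasoning
  0<1 : 0ℚ < 1ℚ
  0<1 = ℚP.positive⁻¹ 1ℚ

sum-nonneg : ∀ {A : Set} (f : A → ℚ) → (∀ x → 0ℚ Q.≤ f x) → ∀ xs → 0ℚ Q.≤ sumℚ (map f xs)
sum-nonneg f f≥0 []       = ℚP.≤-refl
sum-nonneg f f≥0 (x ∷ xs) =
  ℚP.≤-trans (ℚP.≤-reflexive (sym (ℚP.+-identityʳ 0ℚ))) (ℚP.+-mono-≤ (f≥0 x) (sum-nonneg f f≥0 xs))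

sum-mono : ∀ {A : Set} (f g : A → ℚ) xs → (∀ x → x ∈ xs → f x Q.≤ g x) → sumℚ (map f xs) Q.≤ sumℚ (map g xs)
sum-mono f g []       f≤g = ℚP.≤-refl
sum-mono f g (x ∷ xs) f≤g = ℚP.+-mono-≤ (f≤g x (here refl)) (sum-mono f g xs λ y y∈ → f≤g y (there y∈))

sum-++ : ∀ {A : Set} (f : A → ℚ) xs ys → sumℚ (map f (xs ++ ys)) ≡ sumℚ (map f xs) + sumℚ (map f ys)
sum-++ f []       ys = sym (ℚP.+-identityˡ _)
sum-++ f (x ∷ xs) ys = trans (cong (f x +_) (sum-++ f xs ys)) (sym (ℚP.+-assoc (f x) _ _))

sum-concatMap : ∀ {A B : Set} (f : A → ℚ) (g : B → List A) ks →
  sumℚ (map f (concatMap g ks)) ≡ sumℚ (map (λ k → sumℚ (map f (g k))) ks)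
sum-concatMap f g []       = refl
sum-concatMap f g (k ∷ ks) = trans (sum-++ f (g k) (concatMap g ks)) (cong (sumℚ (map f (g k)) +_) (sum-concatMap f g ks))

sum-scale : ∀ {A : Set} (c : ℚ) (f : A → ℚ) xs → sumℚ (map (λ x → c * f x) xs) ≡ c * sumℚ (map f xs)
sum-scale c f []       = sym (ℚP.*-zeroʳ c)
sum-scale c f (x ∷ xs) = trans (cong (c * f x +_) (sum-scale c f xs)) (sym (ℚP.*-distribˡ-+ c (f x) _))

sum-filter : ∀ {A : Set} {P : A → Set} (P? : ∀ x → Dec (P x)) (f g : A → ℚ) →
  (∀ x → P x → f x Q.≤ g x) → (∀ x → 0ℚ Q.≤ g x) → ∀ xs → sumℚ (map f (filter P? xs)) Q.≤ sumℚ (map g xs)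
sum-filter P? f g f≤g g≥0 []       = ℚP.≤-refl
sum-filter P? f g f≤g g≥0 (x ∷ xs) with P? x
... | yes px = ℚP.+-mono-≤ (f≤g x px) (sum-filter P? f g f≤g g≥0 xs)
... | no  _  = ℚP.≤-trans (sum-filter P? f g f≤g g≥0 xs)
                 (ℚP.≤-trans (ℚP.≤-reflexive (sym (ℚP.+-identityˡ _))) (ℚP.+-monoˡ-≤ _ (g≥0 x)))

module Walks {m : ℕ} {V : Set} (ends : Fin m → V × V) where

  edge-ok : ∀ {Q : Fin m → Set} {u v} (W : Walk ends Q u v) → ∀ e → e ∈ wEdges W → Q e
  edge-ok (step e q j W) .e (here refl) = q
  edge-ok (step e q j W) e' (there e'∈) = edge-ok W e' e'∈

  retag : ∀ {Q Q' : Fin m → Set} {u v} (W : Walk ends Q u v) →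
          (∀ e → e ∈ wEdges W → Q' e) → Walk ends Q' u v
  retag []             ok = []
  retag (step e q j W) ok = step e (ok e (here refl)) j (retag W (λ e' e'∈ → ok e' (there e'∈)))

  _++w_ : ∀ {Q : Fin m → Set} {u v w} → Walk ends Q u v → Walk ends Q v w → Walk ends Q u w
  []             ++w W' = W'
  step e q j W   ++w W' = step e q j (W ++w W')

  ++w-edges : ∀ {Q : Fin m → Set} {u v w} (W : Walk ends Q u v) (W' : Walk ends Q v w) →
              wEdges (W ++w W') ≡ wEdges W ++ wEdges W'
  ++w-edges []             W' = refl
  ++w-edges (step e q j W) W' = cong (e ∷_) (++w-edges W W')

  joins-sym : ∀ {e u w} → Joins ends e u w → Joins ends e w u
  joins-sym (inj₁ eq) = inj₂ eq
  joins-sym (inj₂ eq) = inj₁ eq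

  reverseW : ∀ {Q : Fin m → Set} {u v} → Walk ends Q u v → Walk ends Q v u
  reverseW []             = []
  reverseW (step e q j W) = reverseW W ++w step e q (joins-sym j) []

  reverseW-edges : ∀ {Q : Fin m → Set} {u v} (W : Walk ends Q u v) → ∀ e → e ∈ wEdges (reverseW W) → e ∈ wEdges W
  reverseW-edges (step e' q j W) e e∈
    rewrite ++w-edges (reverseW W) (step e' q (joins-sym j) []) with ∈-++⁻ (wEdges (reverseW W)) e∈
  ... | inj₁ e∈W         = there (reverseW-edges W e e∈W)
  ... | inj₂ (here refl) = here refl

  orient : ∀ {Q : Fin m → Set} {e a b} → Joins ends e a b → Walk ends Q a b →
           Walk ends Q (proj₁ (ends e)) (proj₂ (ends e))
  orient (inj₁ eq) W rewrite eq = W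
  orient (inj₂ eq) W rewrite eq = reverseW W

  unorient : ∀ {Q : Fin m → Set} {e a b} → Joins ends e a b →
             Walk ends Q (proj₁ (ends e)) (proj₂ (ends e)) → Walk ends Q a b
  unorient (inj₁ eq) W rewrite eq = W
  unorient (inj₂ eq) W rewrite eq = reverseW W

  joins-cases : ∀ {e a b c d} → Joins ends e a b → Joins ends e c d →
                ((a ≡ c) × (b ≡ d)) ⊎ ((a ≡ d) × (b ≡ c))
  joins-cases (inj₁ x) (inj₁ y) = let eq = trans (sym x) y in inj₁ (,-injectiveˡ eq , ,-injectiveʳ eq)
  joins-cases (inj₁ x) (inj₂ y) = let eq = trans (sym x) y in inj₂ (,-injectiveˡ eq , ,-injectiveʳ eq)
  joins-cases (inj₂ x) (inj₁ y) = let eq = trans (sym x) y in inj₂ (,-injectiveʳ eq , ,-injectiveˡ eq)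
  joins-cases (inj₂ x) (inj₂ y) = let eq = trans (sym x) y in inj₁ (,-injectiveʳ eq , ,-injectiveˡ eq)

  joins-endpoint : ∀ {e u w} → Joins ends e u w → (u ≡ proj₁ (ends e)) ⊎ (u ≡ proj₂ (ends e))
  joins-endpoint (inj₁ eq) rewrite eq = inj₁ refl
  joins-endpoint (inj₂ eq) rewrite eq = inj₂ refl

  start∈wVerts : ∀ {Q : Fin m → Set} {u v} (W : Walk ends Q u v) → u ∈ wVerts W
  start∈wVerts []             = here refl
  start∈wVerts (step _ _ _ _) = here refl

  ends∈wVerts : ∀ {Q : Fin m → Set} {u v} (W : Walk ends Q u v) → ∀ e → e ∈ wEdges W →
                (proj₁ (ends e) ∈ wVerts W) × (proj₂ (ends e) ∈ wVerts W)
  ends∈wVerts (step e q (inj₁ eq) W) .e (here refl) rewrite eq = here refl , there (start∈wVerts W)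
  ends∈wVerts (step e q (inj₂ eq) W) .e (here refl) rewrite eq = there (start∈wVerts W) , here refl
  ends∈wVerts (step e q j W) e' (there e'∈) = let (p₁ , p₂) = ends∈wVerts W e' e'∈ in there p₁ , there p₂

  first-edge-once : ∀ {Q : Fin m → Set} {u w v e q} {j : Joins ends e u w} (W : Walk ends Q w v) →
                    Unique (wVerts (step e q j W)) → e ∉ wEdges W
  first-edge-once {j = j} W (u∉ ∷ _) e∈ with ends∈wVerts W _ e∈ | joins-endpoint j
  ... | p₁ , _  | inj₁ eq = All.lookup u∉ p₁ eq
  ... | _  , p₂ | inj₂ eq = All.lookup u∉ p₂ eq

  Acyclic : List (Fin m) → Set
  Acyclic F = ∀ e → e ∈ F → ¬ Walk ends (InMinus F e) (proj₁ (ends e)) (proj₂ (ends e))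

  -- In an acyclic F, a simple walk uses only edges that every walk with the
  -- same endpoints uses (paths in forests are unique).
  simple-walk-edges⊆ : ∀ (F : List (Fin m)) → Acyclic F → ∀ {a b} (W₁ : Walk ends (_∈ F) a b) →
    Unique (wVerts W₁) → (W₂ : Walk ends (_∈ F) a b) → ∀ e → e ∈ wEdges W₁ → e ∈ wEdges W₂
  simple-walk-edges⊆ F acyclic {a} (step {w = w} e q j W₁) simple@(_ ∷ simple₁) W₂ e' e'∈ = edge e'∈
    where
    e∉W₁ : e ∉ wEdges W₁
    e∉W₁ = first-edge-once {q = q} {j = j} W₁ simple
    -- otherwise W₂ followed by W₁ reversed closes a cycle through e
    e∈W₂ : e ∈ wEdges W₂
    e∈W₂ = decidable-stable (DecMembership._∈?_ Fin._≟_ e (wEdges W₂)) λ e∉W₂ →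
      acyclic e q (orient j (retag C λ e'' e''∈ → edge-ok C e'' e''∈ , λ { refl → avoids e∉W₂ e''∈ }))
      where
      C : Walk ends (_∈ F) a w
      C = W₂ ++w reverseW W₁
      avoids : e ∉ wEdges W₂ → e ∉ wEdges C
      avoids e∉W₂ e∈C rewrite ++w-edges W₂ (reverseW W₁) =
        [ e∉W₂ , (λ e∈ → e∉W₁ (reverseW-edges W₁ e e∈)) ]′ (∈-++⁻ (wEdges W₂) e∈C)
    edge : e' ∈ e ∷ wEdges W₁ → e' ∈ wEdges W₂
    edge (here refl) = e∈W₂
    edge (there e'∈W₁) with simple-walk-edges⊆ F acyclic W₁ simple₁ (step e q (joins-sym j) W₂) e' e'∈W₁
    ... | here refl  = ⊥-elim (e∉W₁ e'∈W₁)
    ... | there e'∈  = e'∈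

  record TailAfter (F : List (Fin m)) (r : V) (edgesW : List (Fin m)) (e : Fin m) : Set where
    field
      {near far} : V
      joins      : Joins ends e near far
      tail       : Walk ends (_∈ F) far r
      simple     : Unique (wVerts tail)
      ⊆walk      : ∀ e' → e' ∈ wEdges tail → e' ∈ edgesW
      avoids     : e ∉ wEdges tail

  tail-after : ∀ {F : List (Fin m)} {v r} (W : Walk ends (_∈ F) v r) → Unique (wVerts W) →
               ∀ e → e ∈ wEdges W → TailAfter F r (wEdges W) e
  tail-after (step e q j W) simple@(_ ∷ simple₁) .e (here refl) = record
    { joins = j ; tail = W ; simple = simple₁ ; ⊆walk = λ _ → there
    ; avoids = first-edge-once {q = q} {j = j} W simple }
  tail-after (step e' q j W) (_ ∷ simple₁) e (there e∈) =
    let t = tail-after W simple₁ e e∈ in record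
    { joins = TailAfter.joins t ; tail = TailAfter.tail t ; simple = TailAfter.simple t
    ; ⊆walk = λ e'' e''∈ → there (TailAfter.⊆walk t e'' e''∈) ; avoids = TailAfter.avoids t }

  beyond-edges-shared : ∀ {F : List (Fin m)} {r} → Acyclic F → ∀ {e edgesW} (t : TailAfter F r edgesW e) →
    ∀ e' → e' ∈ wEdges (TailAfter.tail t) →
    ∀ {v} (W : Walk ends (_∈ F) v r) → Unique (wVerts W) → e ∈ wEdges W → e' ∈ wEdges W
  beyond-edges-shared {F} acyclic {e} t e' e'∈ W simple e∈W
    with tail-after W simple e e∈W
  ... | t' with joins-cases (TailAfter.joins t) (TailAfter.joins t')
  ... | inj₁ (refl , refl) =
    TailAfter.⊆walk t' e' (simple-walk-edges⊆ F acyclic (TailAfter.tail t) (TailAfter.simple t) (TailAfter.tail t') e' e'∈)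
  ... | inj₂ (refl , refl)
    with simple-walk-edges⊆ F acyclic (TailAfter.tail t) (TailAfter.simple t)
           (step e (edge-ok W e e∈W) (joins-sym (TailAfter.joins t)) (TailAfter.tail t')) e' e'∈
  ... | here refl = ⊥-elim (TailAfter.avoids t e'∈)
  ... | there e'∈' = TailAfter.⊆walk t' e' e'∈'

module SpanningTrees {m : ℕ} {V : Set} (ends : Fin m → V × V) (len : Fin m → ℚ)
                     (len≥0 : ∀ e → 0ℚ Q.≤ len e) (P : V → Set) (Q : Fin m → Set) (s : V) where
  open Walks ends

  Connects : List (Fin m) → Set
  Connects S = ∀ v → P v → Walk ends (_∈ S) v s

  SpanningTreeBelow : List (Fin m) → Set
  SpanningTreeBelow S = Σ (List (Fin m)) λ F → IsSpanningTree ends P Q s F × weight len F Q.≤ weight len S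

  _≢?_ : (e x : Fin m) → Dec (x ≢ e)
  (e ≢? x) = ¬? (x Fin.≟ e)

  remove : Fin m → List (Fin m) → List (Fin m)
  remove e = filter (e ≢?_)

  remove-shorter : ∀ {e S} → e ∈ S → length (remove e S) ℕ.< length S
  remove-shorter {e} {S} e∈S = ListP.filter-notAll (e ≢?_) S (Any.map (λ e≡x x≢e → x≢e (sym e≡x)) e∈S)

  remove-lighter : ∀ e S → weight len (remove e S) Q.≤ weight len S
  remove-lighter e = sum-filter (e ≢?_) len len (λ _ _ → ℚP.≤-refl) len≥0

  bypass : ∀ {S e} → Walk ends (InMinus S e) (proj₁ (ends e)) (proj₂ (ends e)) →
           ∀ {a b} → Walk ends (_∈ S) a b → Walk ends (_∈ remove e S) a b
  bypass C [] = []
  bypass {S} {e} C (step e' e'∈S j W) with e' Fin.≟ e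
  ... | no e'≢e  = step e' (∈-filter⁺ (e ≢?_) e'∈S e'≢e) j (bypass C W)
  ... | yes refl = unorient j (retag C (λ e'' e''∈ → let (e''∈S , e''≢e) = edge-ok C e'' e''∈ in
                                          ∈-filter⁺ (e ≢?_) e''∈S e''≢e)) ++w bypass C W

  -- Removing edges of cycles one at a time, every connected duplicate-free
  -- edge set of the graph contains a spanning tree (classically).
  ¬¬-spanning-tree-below : ∀ k S → length S ℕ.≤ k → Unique S → All Q S → Connects S →
                           ¬ ¬ SpanningTreeBelow S
  ¬¬-spanning-tree-below k S |S|≤k unique inGraph connects = ¬¬-excluded-middle >>= λ where
      (no acyclic) →
        return (S , (unique , inGraph , connects , λ e e∈S C → acyclic (e , e∈S , C)) , ℚP.≤-refl)
      (yes (e , e∈S , C)) → drop-cycle-edge (ℕP.<-≤-trans (remove-shorter e∈S) |S|≤k) C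
    where
    drop-cycle-edge : ∀ {k' e} → length (remove e S) ℕ.< k' →
                      Walk ends (InMinus S e) (proj₁ (ends e)) (proj₂ (ends e)) → ¬ ¬ SpanningTreeBelow S
    drop-cycle-edge {suc k'} {e} shorter C =
      ¬¬-spanning-tree-below k' (remove e S) (ℕP.≤-pred shorter)
        (UniqueP.filter⁺ (e ≢?_) unique) (AllP.filter⁺ (e ≢?_) inGraph) (λ v pv → bypass C (connects v pv))
      >>= λ (F , tree , F≤S') → return (F , tree , ℚP.≤-trans F≤S' (remove-lighter e S))

  listsUpTo : ℕ → List (List (Fin m))
  listsUpTo zero    = [] ∷ []
  listsUpTo (suc k) = [] ∷ concatMap (λ e → map (e ∷_) (listsUpTo k)) (allFin m)

  ∈-listsUpTo : ∀ k xs → length xs ℕ.≤ k → xs ∈ listsUpTo k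
  ∈-listsUpTo zero    []       _           = here refl
  ∈-listsUpTo (suc k) []       _           = here refl
  ∈-listsUpTo (suc k) (x ∷ xs) (ℕ.s≤s |xs|≤k) =
    there (∈-concatMap⁺ (λ e → map (e ∷_) (listsUpTo k))
             (Any.map (λ { refl → ∈-map⁺ (x ∷_) (∈-listsUpTo k xs |xs|≤k) }) (∈-allFin x)))

  unique-length≤ : ∀ {xs : List (Fin m)} → Unique xs → ∀ ys → (∀ x → x ∈ xs → x ∈ ys) → length xs ℕ.≤ length ys
  unique-length≤ []              ys xs⊆ys = ℕ.z≤n
  unique-length≤ {x ∷ xs} (x∉ ∷ unique) ys xs⊆ys = ℕP.≤-trans
    (ℕ.s≤s (unique-length≤ unique (remove x ys)
      (λ y y∈ → ∈-filter⁺ (x ≢?_) (xs⊆ys y (there y∈)) (λ { refl → All.lookup x∉ y∈ refl }))))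
    (remove-shorter (xs⊆ys x (here refl)))

  -- a spanning tree has at most m edges, so it is among the lists of length ≤ m
  tree∈listsUpTo : ∀ F → IsSpanningTree ends P Q s F → F ∈ listsUpTo m
  tree∈listsUpTo F (unique , _) = ∈-listsUpTo m F
    (subst (length F ℕ.≤_) (ListP.length-tabulate {n = m} (λ x → x))
           (unique-length≤ unique (allFin m) (λ x _ → ∈-allFin x)))

  ¬¬-MST-below : ∀ F → IsSpanningTree ends P Q s F →
    ¬ ¬ (Σ (List (Fin m)) λ F* → IsMST ends len P Q s F* × weight len F* Q.≤ weight len F)
  ¬¬-MST-below F tree = ¬¬-minimum (IsSpanningTree ends P Q s) (weight len) (listsUpTo m) F tree
    >>= λ (F* , tree* , F*≤F , minimal) →
    return (F* , (tree* , λ F' tree' → minimal F' (tree∈listsUpTo F' tree') tree') , F*≤F)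

  -- An (α,β)-LAST weighs at most β times any connected duplicate-free edge set
  -- of the graph: the set contains a spanning tree, which is no lighter than an
  -- MST.  The double negations are discharged since ≤ on ℚ is decidable.
  LAST-weight≤ : ∀ {α β L} S → 0ℚ Q.≤ β → IsLAST ends len α β P Q s L →
                 Unique S → All Q S → Connects S → weight len L Q.≤ β * weight len S
  LAST-weight≤ {α} {β} {L} S β≥0 (_ , _ , L≤βMST) unique inGraph connects =
    decidable-stable (weight len L Q.≤? β * weight len S) do
      (F , tree , F≤S) ← ¬¬-spanning-tree-below (length S) S ℕP.≤-refl unique inGraph connects
      (F* , mst , F*≤F) ← ¬¬-MST-below F tree
      return (ℚP.≤-trans (L≤βMST F* mst)
        (ℚP.*-monoˡ-≤-nonNeg β {{Q.nonNegative β≥0}} (ℚP.≤-trans F*≤F F≤S)))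

-- Routing trees: flows grow towards the root, so buy edges reach the root

module RoutingTrees (I : Instance) where
  open Instance I
  open Walks ends

  flow-mono : ∀ {F e e' vs x x'} → FlowSum I F e vs x → FlowSum I F e' vs x' →
              (∀ v → OnPath I F e v → OnPath I F e' v) → x ℕ.≤ x'
  flow-mono fnil             fnil             _    = ℕ.z≤n
  flow-mono (fon {v} _ sum)  (fon _ sum')     e⇒e' = ℕP.+-monoʳ-≤ (dem v) (flow-mono sum sum' e⇒e')
  flow-mono (fon on sum)     (foff ¬on' sum') e⇒e' = ⊥-elim (¬on' (e⇒e' _ on))
  flow-mono (foff _ sum)     (fon {v} _ sum') e⇒e' = ℕP.≤-trans (flow-mono sum sum' e⇒e') (ℕP.m≤n+m _ (dem v))
  flow-mono (foff _ sum)     (foff _ sum')    e⇒e' = flow-mono sum sum' e⇒e'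

  flow-positive : ∀ {F e vs x} → FlowSum I F e vs x → 0 ℕ.< x → Σ (Fin n) (OnPath I F e)
  flow-positive (fon {v} on _) _   = v , on
  flow-positive (foff _ sum)   x>0 = flow-positive sum x>0

  buy-term-nonneg : NonnegLengths I → ∀ ε i T e → 0ℚ Q.≤ (if isBuy I ε i T e then len e else 0ℚ)
  buy-term-nonneg len≥0 ε i T e =
    if-elim (0ℚ Q.≤_) (M I ε i Q.≤? toℚ (flow T e)) (λ _ → len≥0 e) (λ _ → ℚP.≤-refl)

  Bcost-nonneg : NonnegLengths I → ∀ ε i T → 0ℚ Q.≤ Bcost I ε i T
  Bcost-nonneg len≥0 ε i T = sum-nonneg _ (buy-term-nonneg len≥0 ε i T) (edges T)

  BuyEdge : ℚ → ℕ → RTree I → Fin m → Set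
  BuyEdge ε i T e = (e ∈ edges T) × (M I ε i Q.≤ toℚ (flow T e))

  -- Every vertex of the core C_i of a routing tree T is joined to r by buy
  -- edges: the path from a buy edge e to r is shared by all demands routed
  -- through e, so its edges carry at least x_e ≥ M_i.
  core-to-root : ∀ {ε} i T → 0ℚ Q.≤ ε → ValidRTree I T → ∀ v → InCore I ε i T v →
                 Walk ends (BuyEdge ε i T) v root
  core-to-root i T ε≥0 valid v (inj₁ refl) = []
  core-to-root {ε} i T ε≥0 (routing , flows) v (inj₂ (e , e∈T , buy , v-end)) =
    [ (λ v≡near → subst (λ u → Walk ends (BuyEdge ε i T) u root) (sym v≡near)
                     (step e (e∈T , buy) (TailAfter.joins t) beyond))
    , (λ v≡far → subst (λ u → Walk ends (BuyEdge ε i T) u root) (sym v≡far) beyond)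
    ]′ (endpoint (TailAfter.joins t) v-end)
    where
    flow-e = flows e e∈T
    x>0 : ∀ {x} → M I ε i Q.≤ toℚ x → 0 ℕ.< x
    x>0 {zero}  M≤0 = ⊥-elim (1≰0 (ℚP.≤-trans (1≤M I ε≥0 i) M≤0))
    x>0 {suc x} _   = ℕ.s≤s ℕ.z≤n
    demand = flow-positive flow-e (x>0 buy)
    W = proj₁ (proj₂ demand)
    t = tail-after W (proj₁ (proj₂ (proj₂ demand))) e (proj₂ (proj₂ (proj₂ demand)))
    beyond-buy : ∀ e' → e' ∈ wEdges (TailAfter.tail t) → BuyEdge ε i T e'
    beyond-buy e' e'∈ = e'∈T , ℚP.≤-trans buy (toℚ-mono (flow-mono flow-e (flows e' e'∈T)
        λ u (Wu , simple , e∈Wu) → Wu , simple , beyond-edges-shared (proj₂ (proj₂ (proj₂ routing))) t e' e'∈ Wu simple e∈Wu))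
      where e'∈T = edge-ok (TailAfter.tail t) e' e'∈
    beyond : Walk ends (BuyEdge ε i T) (TailAfter.far t) root
    beyond = retag (TailAfter.tail t) beyond-buy
    endpoint : ∀ {z₀ z} → Joins ends e z₀ z → (v ≡ proj₁ (ends e)) ⊎ (v ≡ proj₂ (ends e)) → (v ≡ z₀) ⊎ (v ≡ z)
    endpoint (inj₁ eq) (inj₁ v≡) = inj₁ (trans v≡ (cong proj₁ eq))
    endpoint (inj₁ eq) (inj₂ v≡) = inj₂ (trans v≡ (cong proj₂ eq))
    endpoint (inj₂ eq) (inj₁ v≡) = inj₂ (trans v≡ (cong proj₁ eq))
    endpoint (inj₂ eq) (inj₂ v≡) = inj₁ (trans v≡ (cong proj₂ eq))

-- Contraction: the buy edges of T_i span (G/T)[C_i]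

module Contraction (I : Instance) {ε : ℚ} (ε≥0 : 0ℚ Q.≤ ε) (i : ℕ) (T : RTree I) (valid : ValidRTree I T)
                   (TT : List (Fin (Instance.m I))) where
  open Instance I
  open Walks
  open RoutingTrees I

  H-ends : Fin m → Maybe (Fin n) × Maybe (Fin n)
  H-ends = contrEnds I TT

  HV : Maybe (Fin n) → Set
  HV = HVert I TT (InCore I ε i T)

  HE : Fin m → Set
  HE = HEdge I TT (InCore I ε i T)

  contr-in : ∀ {v} → v ∈ treeVerts I TT → contr I TT v ≡ nothing
  contr-in {v} v∈ = if-elim (_≡ nothing) (DecMembership._∈?_ Fin._≟_ v (treeVerts I TT)) (λ _ → refl) (λ v∉ → ⊥-elim (v∉ v∈))

  contr-out : ∀ {v} → v ∉ treeVerts I TT → contr I TT v ≡ just v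
  contr-out {v} v∉ = if-elim (_≡ just v) (DecMembership._∈?_ Fin._≟_ v (treeVerts I TT)) (λ v∈ → ⊥-elim (v∉ v∈)) (λ _ → refl)

  core-in-H : ∀ v → InCore I ε i T v → HV (contr I TT v)
  core-in-H v core with DecMembership._∈?_ Fin._≟_ v (treeVerts I TT)
  ... | yes v∈ = inj₁ (contr-in v∈)
  ... | no  v∉ = inj₂ (v , contr-out v∉ , core , v∉)

  NotLoop : Fin m → Set
  NotLoop e = proj₁ (H-ends e) ≢ proj₂ (H-ends e)

  Survivor : Fin m → Set
  Survivor e = (M I ε i Q.≤ toℚ (flow T e)) × NotLoop e

  survivor? : ∀ e → Dec (Survivor e)
  survivor? e = (M I ε i Q.≤? toℚ (flow T e)) ×-dec ¬? (MaybeP.≡-dec Fin._≟_ (proj₁ (H-ends e)) (proj₂ (H-ends e)))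

  S : List (Fin m)
  S = filter survivor? (edges T)

  contract-walk : ∀ {a b} → Walk ends (BuyEdge ε i T) a b → Walk H-ends (_∈ S) (contr I TT a) (contr I TT b)
  contract-walk [] = []
  contract-walk {a} (step {w = w} e (e∈T , buy) j W)
    with MaybeP.≡-dec Fin._≟_ (contr I TT a) (contr I TT w)
  ... | yes a≡w = subst (λ x → Walk H-ends (_∈ S) x _) (sym a≡w) (contract-walk W)
  ... | no  a≢w = step e (∈-filter⁺ survivor? e∈T (buy , not-loop j)) (contract-joins j) (contract-walk W)
    where
    contract-joins : Joins ends e a w → Joins H-ends e (contr I TT a) (contr I TT w)
    contract-joins (inj₁ eq) = inj₁ (cong (λ p → contr I TT (proj₁ p) , contr I TT (proj₂ p)) eq)
    contract-joins (inj₂ eq) = inj₂ (cong (λ p → contr I TT (proj₁ p) , contr I TT (proj₂ p)) eq)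
    not-loop : Joins ends e a w → NotLoop e
    not-loop (inj₁ eq) rewrite eq = a≢w
    not-loop (inj₂ eq) rewrite eq = λ w≡a → a≢w (sym w≡a)

  S-connects : ∀ x → HV x → Walk H-ends (_∈ S) x nothing
  S-connects x (inj₁ refl) = []
  S-connects x (inj₂ (v , refl , core , v∉)) =
    subst₂ (Walk H-ends (_∈ S)) (contr-out v∉) (contr-in (here refl))
      (contract-walk (core-to-root i T ε≥0 valid v core))

  S-in-H : All HE S
  S-in-H = All.tabulate λ {e} e∈S →
    let (e∈T , buy , not-loop) = ∈-filter⁻ survivor? {xs = edges T} e∈S in
    core-in-H _ (inj₂ (e , e∈T , buy , inj₁ refl)) , core-in-H _ (inj₂ (e , e∈T , buy , inj₂ refl)) , not-loop

  S-unique : Unique S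
  S-unique = UniqueP.filter⁺ survivor? (proj₁ (proj₁ valid))

  S≤B : NonnegLengths I → weight len S Q.≤ Bcost I ε i T
  S≤B len≥0 = sum-filter survivor? len (λ e → if isBuy I ε i T e then len e else 0ℚ)
    (λ e (buy , _) → if-elim (len e Q.≤_) (M I ε i Q.≤? toℚ (flow T e)) (λ _ → ℚP.≤-refl) (λ ¬buy → ⊥-elim (¬buy buy)))
    (buy-term-nonneg len≥0 ε i T) (edges T)

  LAST≤βB : ∀ {α β L} → NonnegLengths I → 0ℚ Q.≤ β →
            IsLAST H-ends len α β HV HE nothing L → weight len L Q.≤ β * Bcost I ε i T
  LAST≤βB {α} {β} len≥0 β≥0 last = ℚP.≤-trans
    (SpanningTrees.LAST-weight≤ H-ends len len≥0 HV HE nothing {α} S β≥0 last S-unique S-in-H S-connects)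
    (ℚP.*-monoˡ-≤-nonNeg β {{Q.nonNegative β≥0}} (S≤B len≥0))

-- Every property of all step-(1) trees T_0..T_K holds of the final trees,
-- since steps (2) and (3) only replace trees by other such trees.
final-trees-preserve : ∀ I ε K (T0 : ℕ → RTree I) (P : RTree I → Set) →
  (∀ i → i ≤ K → P (T0 i)) → ∀ j → P (finalTrees I ε K T0 j)
final-trees-preserve I ε K T0 P P-T0 j = after-step3 (K ∸ j)
  where
  after-step2 : ∀ i → i ≤ K → P (step2 I ε T0 i)
  after-step2 zero    i≤K = P-T0 zero i≤K
  after-step2 (suc i) i≤K = if-elim P (Acost I ε (suc i) (step2 I ε T0 i) Q.<? Acost I ε (suc i) (T0 (suc i)))
    (λ _ → after-step2 i (ℕP.≤-trans (ℕP.n≤1+n i) i≤K)) (λ _ → P-T0 (suc i) i≤K)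
  after-step3 : ∀ k → P (step3aux I ε K (step2 I ε T0) k)
  after-step3 zero    = after-step2 K ℕP.≤-refl
  after-step3 (suc k) = if-elim P
    (Acost I ε (K ∸ suc k) (step3aux I ε K (step2 I ε T0) k) Q.<? Acost I ε (K ∸ suc k) (step2 I ε T0 (K ∸ suc k)))
    (λ _ → after-step3 k) (λ _ → after-step2 (K ∸ suc k) (ℕP.m∸n≤m K (suc k)))

module Step5 (I : Instance) (γ : ℚ) (γ≥1 : 1ℚ Q.≤ γ) (B : ℕ → ℚ) (B≥0 : ∀ j → 0ℚ Q.≤ B j) where

  B≤Bγ : ∀ j → B j Q.≤ B j * γ
  B≤Bγ j = ℚP.≤-trans (ℚP.≤-reflexive (sym (ℚP.*-identityʳ (B j))))
                      (ℚP.*-monoˡ-≤-nonNeg (B j) {{Q.nonNegative (B≥0 j)}} γ≥1)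

  step5-below : ∀ is b → All (λ j → B j * γ < b) (step5 I γ B is (just b))
  step5-below []       b = []
  step5-below (i ∷ is) b = if-elim (All (λ j → B j * γ < b)) (B i * γ Q.<? b)
    (λ Biγ<b → Biγ<b ∷ All.map (λ Bjγ<Bi → ℚP.<-trans Bjγ<Bi (ℚP.≤-<-trans (B≤Bγ i) Biγ<b)) (step5-below is (B i)))
    (λ _ → step5-below is b)

  step5-decreasing : ∀ is mb → AllPairs (λ p q → B q * γ < B p) (step5 I γ B is mb)
  step5-decreasing []       mb       = []
  step5-decreasing (i ∷ is) nothing  = step5-below is (B i) ∷ step5-decreasing is (just (B i))
  step5-decreasing (i ∷ is) (just b) = if-elim (AllPairs (λ p q → B q * γ < B p)) (B i * γ Q.<? b)
    (λ _ → step5-below is (B i) ∷ step5-decreasing is (just (B i)))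
    (λ _ → step5-decreasing is (just b))

module Step6 (I : Instance) (δ : ℚ) (R : ℕ → ℚ) where

  step6-⊆ : ∀ is mb {x} → x ∈ step6 I δ R is mb → x ∈ is
  step6-⊆ (i ∷ is) nothing  (here refl) = here refl
  step6-⊆ (i ∷ is) nothing  (there x∈)  = there (step6-⊆ is _ x∈)
  step6-⊆ (i ∷ is) (just b) {x} = if-elim (λ l → x ∈ l → x ∈ i ∷ is) (R i * δ Q.<? b)
    (λ _ → λ { (here refl) → here refl ; (there x∈) → there (step6-⊆ is _ x∈) })
    (λ _ x∈ → there (step6-⊆ is _ x∈))

  step6-AllPairs : ∀ {Rel : ℕ → ℕ → Set} is mb → AllPairs Rel is → AllPairs Rel (step6 I δ R is mb)
  step6-AllPairs []       mb       []           = []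
  step6-AllPairs (i ∷ is) nothing  (i~is ∷ ~is) =
    All.tabulate (λ x∈ → All.lookup i~is (step6-⊆ is _ x∈)) ∷ step6-AllPairs is _ ~is
  step6-AllPairs {Rel} (i ∷ is) (just b) (i~is ∷ ~is) = if-elim (AllPairs Rel) (R i * δ Q.<? b)
    (λ _ → All.tabulate (λ x∈ → All.lookup i~is (step6-⊆ is _ x∈)) ∷ step6-AllPairs is _ ~is)
    (λ _ → step6-AllPairs is _ ~is)

AllPairs-reverse : ∀ {A : Set} {Rel : A → A → Set} {xs} → AllPairs Rel xs → AllPairs (flip Rel) (reverse xs)
AllPairs-reverse {xs = []}     []           = []
AllPairs-reverse {xs = x ∷ xs} (x~xs ∷ ~xs) rewrite ListP.unfold-reverse x xs =
  AllPairsP.++⁺ (AllPairs-reverse ~xs) ([] ∷ [])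
    (All.tabulate λ y∈ → All.lookup x~xs (AnyP.reverse⁻ y∈) ∷ [])

L-increasing : ∀ I ε γ δ K T0 → 1ℚ Q.≤ γ → (∀ j → 0ℚ Q.≤ Bcost I ε j (finalTrees I ε K T0 j)) →
  let B = λ j → Bcost I ε j (finalTrees I ε K T0 j) in
  AllPairs (λ p q → B p * γ < B q) (Lout I ε γ δ K T0)
L-increasing I ε γ δ K T0 γ≥1 B≥0 =
  Step6.step6-AllPairs I δ (λ j → Rcost I ε j (finalTrees I ε K T0 j)) _ nothing
    (AllPairs-reverse (Step5.step5-decreasing I γ γ≥1 _ B≥0 (upToK I K) nothing))

module GeometricSum {A : Set} (f : A → ℚ) (γ : ℚ) where
  open +-*-Solver
  open ℚP.≤-Reasoning

  Growing : List A → Set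
  Growing = AllPairs (λ a b → f a * γ Q.≤ f b)

  first : A → List A → A
  first i []      = i
  first i (a ∷ _) = a

  next-grows : ∀ a i pre {post} → All (λ b → f a * γ Q.≤ f b) (pre ++ i ∷ post) → f a * γ Q.≤ f (first i pre)
  next-grows a i []      (h ∷ _) = h
  next-grows a i (_ ∷ _) (h ∷ _) = h

  -- strengthened statement carrying the first term, proved by induction on pre
  sum-plus-first : ∀ i pre {post} → Growing (pre ++ i ∷ post) →
    (γ - 1ℚ) * sumℚ (map f (pre ++ i ∷ [])) + f (first i pre) Q.≤ γ * f i
  sum-plus-first i [] _ = ℚP.≤-reflexive
    (solve 2 (λ g x → (g :- con 1ℚ) :* (x :+ con 0ℚ) :+ x := g :* x) refl γ (f i))
  sum-plus-first i (a ∷ pre) (a~ ∷ growing) = begin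
    (γ - 1ℚ) * (f a + total) + f a          ≡⟨ solve 3 (λ g x y → (g :- con 1ℚ) :* (x :+ y) :+ x := (g :- con 1ℚ) :* y :+ x :* g) refl γ (f a) total ⟩
    (γ - 1ℚ) * total + f a * γ              ≤⟨ ℚP.+-monoʳ-≤ ((γ - 1ℚ) * total) (next-grows a i pre a~) ⟩
    (γ - 1ℚ) * total + f (first i pre)      ≤⟨ sum-plus-first i pre growing ⟩
    γ * f i                             ∎
    where total = sumℚ (map f (pre ++ i ∷ []))

  geometric-sum : (∀ a → 0ℚ Q.≤ f a) → ∀ i pre {post} → Growing (pre ++ i ∷ post) →
    (γ - 1ℚ) * sumℚ (map f (pre ++ i ∷ [])) Q.≤ γ * f i
  geometric-sum f≥0 i pre growing = begin
    (γ - 1ℚ) * total                    ≡⟨ sym (ℚP.+-identityʳ _) ⟩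
    (γ - 1ℚ) * total + 0ℚ               ≤⟨ ℚP.+-monoʳ-≤ ((γ - 1ℚ) * total) (f≥0 (first i pre)) ⟩
    (γ - 1ℚ) * total + f (first i pre)  ≤⟨ sum-plus-first i pre growing ⟩
    γ * f i                         ∎
    where total = sumℚ (map f (pre ++ i ∷ []))

A₀-of-LASTs≤ : ∀ {m} (len : Fin m → ℚ) → (∀ e → 0ℚ Q.≤ len e) → (x : Fin m → ℕ)
  (last : ℕ → List (Fin m)) (c : ℚ) (B : ℕ → ℚ) (js : List ℕ) →
  (∀ j → j ∈ js → weight len (last j) Q.≤ c * B j) →
  sumℚ (map (λ e → len e * (toℚ (x e) ⊓ 1ℚ)) (concatMap last js)) Q.≤ c * sumℚ (map B js)
A₀-of-LASTs≤ len len≥0 x last c B js last≤cB = begin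
  sumℚ (map (λ e → len e * (toℚ (x e) ⊓ 1ℚ)) (concatMap last js))
    ≤⟨ sum-mono _ len (concatMap last js) (λ e _ → truncated≤len e) ⟩
  sumℚ (map len (concatMap last js))
    ≡⟨ sum-concatMap len last js ⟩
  sumℚ (map (λ j → weight len (last j)) js)
    ≤⟨ sum-mono _ (λ j → c * B j) js last≤cB ⟩
  sumℚ (map (λ j → c * B j) js)
    ≡⟨ sum-scale c B js ⟩
  c * sumℚ (map B js) ∎
  where
  open ℚP.≤-Reasoning
  truncated≤len : ∀ e → len e * (toℚ (x e) ⊓ 1ℚ) Q.≤ len e
  truncated≤len e = ℚP.≤-trans (ℚP.*-monoˡ-≤-nonNeg (len e) {{Q.nonNegative (len≥0 e)}} (ℚP.p⊓q≤q (toℚ (x e)) 1ℚ))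
                               (ℚP.≤-reflexive (ℚP.*-identityʳ (len e)))

lemma8 : (I : Instance) → NoLoops I → NoParallel I → Connected I → NonnegLengths I →
  1 ≤ totalDemand I →
  (ε λ' α β γ δ : ℚ) → 0ℚ < ε → 1ℚ < α → (α + 1ℚ) Q.≤ β * (α - 1ℚ) → 1ℚ < γ → 1ℚ < δ →
  (K : ℕ) → IsCeilLog I ε K →
  -- step (1): trees returned by the λ-approximation, and optimal trees T*_i
  (T0 Tstar : ℕ → RTree I) →
  (∀ i → i ≤ K → ValidRTree I (T0 i)) →
  (∀ i → i ≤ K → ValidRTree I (Tstar i)) →
  (∀ i → i ≤ K → ∀ T' → ValidRTree I T' → Acost I ε i (Tstar i) Q.≤ Acost I ε i T') →
  (∀ i → i ≤ K → Acost I ε i (T0 i) Q.≤ λ' * Acost I ε i (Tstar i)) →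
  -- Algorithm 2: the LAST T'_i chosen in the iteration for i ∈ L
  (last : ℕ → List (Fin (Instance.m I))) →
  (∀ pre i post → Lout I ε γ δ K T0 ≡ pre ++ (i ∷ post) →
     IsLAST (contrEnds I (concatMap last pre)) (Instance.len I) α β
            (HVert I (concatMap last pre) (InCore I ε i (finalTrees I ε K T0 i)))
            (HEdge I (concatMap last pre) (InCore I ε i (finalTrees I ε K T0 i)))
            nothing (last i)) →
  -- conclusion, for every i ∈ L, with x the flows of the final tree T
  ∀ pre i post → Lout I ε γ δ K T0 ≡ pre ++ (i ∷ post) →
  ∀ x → IsFlowOf I (concatMap last (Lout I ε γ δ K T0)) x →
  sumℚ (map (λ e → Instance.len I e * (toℚ (x e) ⊓ 1ℚ)) (concatMap last (pre ++ (i ∷ [])))) * (γ - 1ℚ)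
    Q.≤ β * γ * Bcost I ε i (finalTrees I ε K T0 i)
lemma8 I _ _ _ len≥0 _ ε _ α β γ δ ε>0 α>1 αβ γ>1 _ K _ T0 _ T0-valid _ _ _ last isLAST pre i post L≡ x _ = begin
  A₀ * (γ - 1ℚ)                 ≤⟨ ℚP.*-monoʳ-≤-nonNeg (γ - 1ℚ) {{Q.nonNegative (0≤p-1 γ≥1)}}
                                     (A₀-of-LASTs≤ (Instance.len I) len≥0 x last β B js LAST≤βB) ⟩
  β * ΣB * (γ - 1ℚ)             ≡⟨ solve 3 (λ b s g → b :* s :* (g :- con 1ℚ) := b :* ((g :- con 1ℚ) :* s)) refl β ΣB γ ⟩
  β * ((γ - 1ℚ) * ΣB)           ≤⟨ ℚP.*-monoˡ-≤-nonNeg β {{Q.nonNegative β≥0}}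
                                     (GeometricSum.geometric-sum B γ B≥0 i pre (subst (Growing B γ) L≡ B-growing)) ⟩
  β * (γ * B i)                 ≡⟨ sym (ℚP.*-assoc β γ (B i)) ⟩
  β * γ * B i                   ∎
  where
  open ℚP.≤-Reasoning
  open +-*-Solver
  open GeometricSum using (Growing)
  γ≥1 : 1ℚ Q.≤ γ
  γ≥1 = ℚP.<⇒≤ γ>1
  β≥0 : 0ℚ Q.≤ β
  β≥0 = β-nonneg α>1 αβ
  B : ℕ → ℚ
  B j = Bcost I ε j (finalTrees I ε K T0 j)
  js : List ℕ
  js = pre ++ i ∷ []
  A₀ ΣB : ℚ
  A₀ = sumℚ (map (λ e → Instance.len I e * (toℚ (x e) ⊓ 1ℚ)) (concatMap last js))
  ΣB = sumℚ (map B js)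
  B≥0 : ∀ j → 0ℚ Q.≤ B j
  B≥0 j = RoutingTrees.Bcost-nonneg I len≥0 ε j (finalTrees I ε K T0 j)
  B-growing : Growing B γ (Lout I ε γ δ K T0)
  B-growing = AllPairs.map ℚP.<⇒≤ (L-increasing I ε γ δ K T0 γ≥1 B≥0)
  ∈-L : ∀ {j} → j ∈ js → j ∈ Lout I ε γ δ K T0
  ∈-L j∈ = subst (_ ∈_) (sym L≡) ([ ∈-++⁺ˡ , (λ { (here refl) → ∈-++⁺ʳ pre (here refl) }) ]′ (∈-++⁻ pre j∈))
  LAST≤βB : ∀ j → j ∈ js → weight (Instance.len I) (last j) Q.≤ β * B j
  LAST≤βB j j∈js with ∈-∃++ (∈-L j∈js)
  ... | pre' , post' , L≡' =
    Contraction.LAST≤βB I (ℚP.<⇒≤ ε>0) j (finalTrees I ε K T0 j)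
      (final-trees-preserve I ε K T0 (ValidRTree I) T0-valid j) (concatMap last pre') {α} len≥0 β≥0
      (isLAST pre' j post' L≡')
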